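{- Let $M_1,\dots,M_n$ ($n\ge2$) be DFAs over a common alphabet $\Sigma$ and let $G$ be the deterministic labeled graph constructed from them as described in the context. If $\bigcap_{i=1}^n L(M_i)\neq\varnothing$, then the minimum length of a synchronizing word for $G$ is $2$ more than the minimum length of a word in $\bigcap_{i=1}^n L(M_i)$.
   Context: A DFA $M_i$ has a finite state set $Q_i$ (pairwise disjoint), total transition function $\delta_i\colon Q_i\times\Sigma\to Q_i$ (viewed as edges $q\to\delta_i(q,a)$ labeled $a$), initial state $s_i$, accepting set $F_i$; $L(M_i)=\{w\in\Sigma^*:\delta_i(s_i,w)\in F_i\}$. Let $\lhd,\rhd$ be distinct symbols not in $\Sigma$. $G$: a vertex $t$ with a self loop labeled $\rhd$; for each $i$, vertices $p_i,r_i$ with self loops labeled $\rhd$, a self loop labeled $a$ on $p_i$ for each $a\in\Sigma$, an embedded copy of $M_i$, an edge labeled $\lhd$ from $p_i$ to $s_i$, an edge labeled $\rhd$ from each $q\in F_i$ to $t$ and from each $q\in Q_i\setminus F_i$ to $r_i$. For this deterministic graph, $Q_G\cdot u$ is the set of end vertices of paths labeled $u$ (paths from any vertex), and $u$ is synchronizing for $G$ if $|Q_G\cdot u|=1$. -}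

module Defs where

open import Data.Nat using (ℕ; _≤_)
open import Data.Fin using (Fin)
open import Data.Bool using (Bool; true; false; if_then_else_)
open import Data.List using (List; []; _∷_; length)
open import Data.Maybe using (Maybe; just; nothing; _>>=_)
open import Data.Product using (Σ; _×_)
open import Relation.Binary.PropositionalEquality using (_≡_)
open import Function.Bundles using (_⇔_)

record DFA (m : ℕ) : Set where
  field
    k : ℕ
    δ : Fin k → Fin m → Fin k
    s : Fin k
    F : Fin k → Bool

open DFA public

δ* : ∀ {m} (M : DFA m) → Fin (k M) → List (Fin m) → Fin (k M)
δ* M q [] = q
δ* M q (a ∷ w) = δ* M (δ M q a) w

_∈L_ : ∀ {m} → List (Fin m) → DFA m → Set
w ∈L M = F M (δ* M (s M) w) ≡ true

InAll : ∀ {n m} → (Fin n → DFA m) → List (Fin m) → Set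
InAll M w = ∀ i → w ∈L M i

data Letter (m : ℕ) : Set where
  sym : Fin m → Letter m
  ◁ : Letter m
  ▷ : Letter m

data Vert {n m : ℕ} (M : Fin n → DFA m) : Set where
  t : Vert M
  p : Fin n → Vert M
  r : Fin n → Vert M
  st : (i : Fin n) → Fin (k (M i)) → Vert M

stepG : ∀ {n m} {M : Fin n → DFA m} → Vert M → Letter m → Maybe (Vert M)
stepG t ▷ = just t
stepG t (sym _) = nothing
stepG t ◁ = nothing
stepG (p i) ▷ = just (p i)
stepG (p i) (sym _) = just (p i)
stepG {M = M} (p i) ◁ = just (st i (s (M i)))
stepG (r i) ▷ = just (r i)
stepG (r i) (sym _) = nothing
stepG (r i) ◁ = nothing
stepG {M = M} (st i q) (sym a) = just (st i (δ (M i) q a))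
stepG {M = M} (st i q) ▷ = if F (M i) q then just t else just (r i)
stepG (st i q) ◁ = nothing

runG : ∀ {n m} {M : Fin n → DFA m} → Vert M → List (Letter m) → Maybe (Vert M)
runG v [] = just v
runG v (a ∷ u) = stepG v a >>= λ v' → runG v' u

_∈QG·_ : ∀ {n m} {M : Fin n → DFA m} → Vert M → List (Letter m) → Set
_∈QG·_ {M = M} y u = Σ (Vert M) λ v → runG v u ≡ just y

Synchronizing : ∀ {n m} (M : Fin n → DFA m) → List (Letter m) → Set
Synchronizing M u = Σ (Vert M) λ x → ∀ y → (y ∈QG· u) ⇔ (y ≡ x)

IsMinLength : {A : Set} → (List A → Set) → ℕ → Set
IsMinLength P ℓ = (Σ _ λ w → P w × length w ≡ ℓ) × (∀ w → P w → ℓ ≤ length w)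

{-# OPTIONS --safe #-}
-- Only the vertices p_i read ◁, and t and the r_i are sinks reading nothing but ▷. A
-- synchronizing word therefore contains ◁, and after its first ◁ the surviving paths sit
-- at the initial states s_i. From there they must read w ▷ with w ∈ Σ*: ending inside Σ*
-- leaves the components apart, and a second ◁ kills every path. After that ▷ each path is
-- at t or at its own r_i, and these coincide only if all are at t, i.e. w ∈ ⋂ L(M_i).
-- Conversely ◁ w ▷ sends every p_i to t and is undefined elsewhere.
module Submission where

open import Defs
open import Data.Nat using (ℕ; _≤_; _+_; suc; s≤s; z≤n)
open import Data.Nat.Properties using (≤-trans; +-monoʳ-≤; +-comm; module ≤-Reasoning)
open import Data.Fin using (Fin; zero; suc; punchIn)
open import Data.Fin.Properties using (0≢1+n; punchInᵢ≢i)
open import Data.List using (List; []; _∷_; _++_; length; map)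
open import Data.List.Properties
  using (length-++; length-map; length-++-≤ˡ; length-++-≤ʳ; length-++-sucʳ)
open import Data.List.Relation.Unary.All using (All; []; _∷_)
open import Data.List.Relation.Unary.All.Properties using (++⁻ʳ)
open import Data.Product using (Σ; ∃; _,_; _×_)
open import Data.Empty using (⊥-elim)
open import Data.Bool using (true; false; if_then_else_)
open import Data.Maybe using (just; nothing; _>>=_)
open import Data.Maybe.Properties using (just-injective)
open import Relation.Binary.PropositionalEquality hiding (sym)
open import Relation.Binary.PropositionalEquality using () renaming (sym to ≡-sym)
open import Function using (_∘_; case_of_)
open import Function.Bundles using (mk⇔; Equivalence)

module _ {n m : ℕ} {M : Fin n → DFA m} where

  p-injective : ∀ {i j} → p {M = M} i ≡ p j → i ≡ j
  p-injective refl = refl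

  r-injective : ∀ {i j} → r {M = M} i ≡ r j → i ≡ j
  r-injective refl = refl

  st-index-injective : ∀ {i j q q′} → st {M = M} i q ≡ st j q′ → i ≡ j
  st-index-injective refl = refl

  data IsSink : Vert M → Set where
    t-sink : IsSink t
    r-sink : ∀ i → IsSink (r i)

  sink-run-▷* : ∀ {v u} → IsSink v → All (_≡ ▷) u → runG v u ≡ just v
  sink-run-▷* _            []         = refl
  sink-run-▷* t-sink       (refl ∷ u) = sink-run-▷* t-sink u
  sink-run-▷* (r-sink i)   (refl ∷ u) = sink-run-▷* (r-sink i) u

  sink-run-defined : ∀ {v y} u → IsSink v → runG v u ≡ just y → All (_≡ ▷) u
  sink-run-defined []          _          _ = []
  sink-run-defined (▷ ∷ u)     t-sink     e = refl ∷ sink-run-defined u t-sink e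
  sink-run-defined (▷ ∷ u)     (r-sink i) e = refl ∷ sink-run-defined u (r-sink i) e
  sink-run-defined (sym _ ∷ _) t-sink     ()
  sink-run-defined (sym _ ∷ _) (r-sink _) ()
  sink-run-defined (◁ ∷ _)     t-sink     ()
  sink-run-defined (◁ ∷ _)     (r-sink _) ()

  sink-never-◁ : ∀ {v y} u₁ {u₂} → IsSink v → runG v (u₁ ++ ◁ ∷ u₂) ≢ just y
  sink-never-◁ u₁ s e with ++⁻ʳ u₁ (sink-run-defined (u₁ ++ _) s e)
  ... | () ∷ _

  exit : (i : Fin n) → Fin (k (M i)) → Vert M
  exit i q = if F (M i) q then t else r i

  exit-sink : ∀ i q → IsSink (exit i q)
  exit-sink i q with F (M i) q
  ... | true  = t-sink
  ... | false = r-sink i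

  run-▷-from-state : ∀ i q u → runG {M = M} (st i q) (▷ ∷ u) ≡ runG (exit i q) u
  run-▷-from-state i q u with F (M i) q
  ... | true  = refl
  ... | false = refl

  run-syms-from-state : ∀ i q w u
    → runG {M = M} (st i q) (map sym w ++ u) ≡ runG (st i (δ* (M i) q w)) u
  run-syms-from-state i q []      u = refl
  run-syms-from-state i q (a ∷ w) u = run-syms-from-state i (δ (M i) q a) w u

  state-never-◁ : ∀ {i q y} u₁ {u₂} → runG {M = M} (st i q) (u₁ ++ ◁ ∷ u₂) ≢ just y
  state-never-◁             []          ()
  state-never-◁             (sym a ∷ u) e = state-never-◁ u e
  state-never-◁ {i} {q}     (▷ ∷ u)     e =
    sink-never-◁ u (exit-sink i q) (trans (≡-sym (run-▷-from-state i q (u ++ ◁ ∷ _))) e)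
  state-never-◁             (◁ ∷ u)     ()

  ◁-path-starts-at-p : ∀ v u₁ {u₂ y} → runG v (u₁ ++ ◁ ∷ u₂) ≡ just y → ∃ λ i → v ≡ p i
  ◁-path-starts-at-p (p i)    _  _ = i , refl
  ◁-path-starts-at-p t        u₁ e = ⊥-elim (sink-never-◁ u₁ t-sink e)
  ◁-path-starts-at-p (r i)    u₁ e = ⊥-elim (sink-never-◁ u₁ (r-sink i) e)
  ◁-path-starts-at-p (st i q) u₁ e = ⊥-elim (state-never-◁ u₁ e)

  p-run-◁-free : ∀ i {u} → All (_≢ ◁) u → runG {M = M} (p i) u ≡ just (p i)
  p-run-◁-free i {[]}        []          = refl
  p-run-◁-free i {sym _ ∷ u} (_ ∷ no◁)   = p-run-◁-free i no◁
  p-run-◁-free i {▷ ∷ u}     (_ ∷ no◁)   = p-run-◁-free i no◁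
  p-run-◁-free i {◁ ∷ u}     (◁≢◁ ∷ _)  = ⊥-elim (◁≢◁ refl)

  runG-++ : ∀ v u u′ → runG {M = M} v (u ++ u′) ≡ (runG v u >>= λ y → runG y u′)
  runG-++ v []      u′ = refl
  runG-++ v (a ∷ u) u′ with stepG v a
  ... | nothing = refl
  ... | just y  = runG-++ y u u′

  p-run-first-◁ : ∀ i {u₁} u₂ → All (_≢ ◁) u₁
    → runG {M = M} (p i) (u₁ ++ ◁ ∷ u₂) ≡ runG (st i (s (M i))) u₂
  p-run-first-◁ i {u₁} u₂ no◁ = begin
    runG (p i) (u₁ ++ ◁ ∷ u₂)                   ≡⟨ runG-++ (p i) u₁ (◁ ∷ u₂) ⟩
    (runG (p i) u₁ >>= λ y → runG y (◁ ∷ u₂))   ≡⟨ cong (_>>= _) (p-run-◁-free i no◁) ⟩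
    runG (st i (s (M i))) u₂                    ∎
    where open ≡-Reasoning

  exit-accepting : ∀ {i j q q′} → i ≢ j → exit i q ≡ exit j q′ → F (M i) q ≡ true
  exit-accepting {i} {j} {q} {q′} i≢j e with F (M i) q | F (M j) q′
  ... | true  | _     = refl
  ... | false | true  = case e of λ ()
  ... | false | false = ⊥-elim (i≢j (r-injective e))

module _ {m : ℕ} where

  accepting-word : List (Fin m) → List (Letter m)
  accepting-word w = ◁ ∷ map sym w ++ ▷ ∷ []

  length-accepting-word : ∀ w → length (accepting-word w) ≡ 2 + length w
  length-accepting-word w =
    cong suc (trans (length-++ (map sym w)) (trans (cong (_+ 1) (length-map sym w)) (+-comm _ 1)))

  data ◁-Split : List (Letter m) → Set where
    ◁-free  : ∀ {u} → All (_≢ ◁) u → ◁-Split u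
    first-◁ : ∀ {u₁} → All (_≢ ◁) u₁ → ∀ u₂ → ◁-Split (u₁ ++ ◁ ∷ u₂)

  ◁-Split-∷ : ∀ {a u} → a ≢ ◁ → ◁-Split u → ◁-Split (a ∷ u)
  ◁-Split-∷ a≢◁ (◁-free no◁)     = ◁-free (a≢◁ ∷ no◁)
  ◁-Split-∷ a≢◁ (first-◁ no◁ u₂) = first-◁ (a≢◁ ∷ no◁) u₂

  ◁-split : ∀ u → ◁-Split u
  ◁-split []          = ◁-free []
  ◁-split (◁ ∷ u)     = first-◁ [] u
  ◁-split (sym a ∷ u) = ◁-Split-∷ (λ ()) (◁-split u)
  ◁-split (▷ ∷ u)     = ◁-Split-∷ (λ ()) (◁-split u)

  data SymPrefix : List (Letter m) → Set where
    then-end : ∀ w   → SymPrefix (map sym w ++ [])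
    then-◁   : ∀ w u → SymPrefix (map sym w ++ ◁ ∷ u)
    then-▷   : ∀ w u → SymPrefix (map sym w ++ ▷ ∷ u)

  symPrefix : ∀ u → SymPrefix u
  symPrefix []          = then-end []
  symPrefix (◁ ∷ u)     = then-◁ [] u
  symPrefix (▷ ∷ u)     = then-▷ [] u
  symPrefix (sym a ∷ u) with symPrefix u
  ... | then-end w   = then-end (a ∷ w)
  ... | then-◁ w u′  = then-◁ (a ∷ w) u′
  ... | then-▷ w u′  = then-▷ (a ∷ w) u′

module _ {n m : ℕ} {M : Fin (suc n) → DFA m} where

  p-run-accepting-word : ∀ w → InAll M w → ∀ i → runG (p i) (accepting-word w) ≡ just t
  p-run-accepting-word w w∈ i = begin
    runG {M = M} (p i) (accepting-word w)          ≡⟨ run-syms-from-state i (s (M i)) w (▷ ∷ []) ⟩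
    runG (st i (δ* (M i) (s (M i)) w)) (▷ ∷ [])    ≡⟨ run-▷-from-state i _ [] ⟩
    just (exit i (δ* (M i) (s (M i)) w))           ≡⟨ cong (λ b → just (if b then t else r i)) (w∈ i) ⟩
    just t                                         ∎
    where open ≡-Reasoning

  accepting-word-synchronizing : ∀ w → InAll M w → Synchronizing M (accepting-word w)
  accepting-word-synchronizing w w∈ =
    t , λ y → mk⇔ (ends-at-t y) λ { refl → p zero , p-run-accepting-word w w∈ zero }
    where
    ends-at-t : ∀ y → y ∈QG· accepting-word w → y ≡ t
    ends-at-t y (v₀ , e) with ◁-path-starts-at-p v₀ [] {map sym w ++ ▷ ∷ []} e
    ... | i , refl = just-injective (trans (≡-sym e) (p-run-accepting-word w w∈ i))

module _ {n m : ℕ} {M : Fin (2 + n) → DFA m} where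

  merging-word-has-accepted-prefix : ∀ {x k₀} (q : ∀ l → Fin (k (M l))) u
    → runG {M = M} (st k₀ (q k₀)) u ≡ just x
    → (∀ l {y} → runG {M = M} (st l (q l)) u ≡ just y → y ≡ x)
    → Σ (List (Fin m)) λ w
        → (∀ l → F (M l) (δ* (M l) (q l) w) ≡ true) × suc (length w) ≤ length u
  merging-word-has-accepted-prefix {x} {k₀} q u e ends with symPrefix u
  ... | then-end w  =
    ⊥-elim (0≢1+n (st-index-injective (trans (ends-from zero) (≡-sym (ends-from (suc zero))))))
    where
    ends-from : ∀ l → st l (δ* (M l) (q l) w) ≡ x
    ends-from l = ends l (run-syms-from-state l (q l) w [])
  ... | then-◁ w u′ = ⊥-elim (state-never-◁ (map sym w) e)
  ... | then-▷ w u′ = w , accepting , prefix-shorter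
    where
    final : ∀ l → Vert M
    final l = exit l (δ* (M l) (q l) w)
    run : ∀ l → runG {M = M} (st l (q l)) (map sym w ++ ▷ ∷ u′) ≡ runG (final l) u′
    run l = trans (run-syms-from-state l (q l) w (▷ ∷ u′)) (run-▷-from-state l _ u′)
    u′-▷* : All (_≡ ▷) u′
    u′-▷* = sink-run-defined u′ (exit-sink k₀ _) (trans (≡-sym (run k₀)) e)
    final≡x : ∀ l → final l ≡ x
    final≡x l = ends l (trans (run l) (sink-run-▷* (exit-sink l _) u′-▷*))
    accepting : ∀ l → F (M l) (δ* (M l) (q l) w) ≡ true
    accepting l =
      exit-accepting (punchInᵢ≢i l zero ∘ ≡-sym) (trans (final≡x l) (≡-sym (final≡x (punchIn l zero))))
    prefix-shorter : suc (length w) ≤ length (map sym w ++ ▷ ∷ u′)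
    prefix-shorter = begin
      suc (length w)                  ≡⟨ cong suc (length-map sym w) ⟨
      suc (length (map sym w))        ≤⟨ s≤s (length-++-≤ˡ (map sym w)) ⟩
      suc (length (map sym w ++ u′))  ≡⟨ length-++-sucʳ (map sym w) ▷ u′ ⟨
      length (map sym w ++ ▷ ∷ u′)    ∎
      where open ≤-Reasoning

  synchronizing-word-has-accepted-factor : ∀ {x} v → x ∈QG· v
    → (∀ v₀ {y} → runG v₀ v ≡ just y → y ≡ x)
    → Σ (List (Fin m)) λ w → InAll M w × 2 + length w ≤ length v
  synchronizing-word-has-accepted-factor {x} v (v₀ , e) ends with ◁-split v
  ... | ◁-free no◁ =
    ⊥-elim (0≢1+n (p-injective (trans (ends-from zero) (≡-sym (ends-from (suc zero))))))
    where
    ends-from : ∀ i → p i ≡ x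
    ends-from i = ends (p i) (p-run-◁-free i no◁)
  ... | first-◁ {u₁} no◁ u₂ with ◁-path-starts-at-p v₀ u₁ e
  ... | k₀ , refl with merging-word-has-accepted-prefix (λ l → s (M l)) u₂
                         (trans (≡-sym (p-run-first-◁ k₀ u₂ no◁)) e)
                         (λ l e′ → ends (p l) (trans (p-run-first-◁ l u₂ no◁) e′))
  ... | w , w∈ , w<u₂ = w , w∈ , ≤-trans (s≤s w<u₂) (length-++-≤ʳ (◁ ∷ u₂) {u₁})

lemma5p1 : (n m : ℕ) → 2 ≤ n → (M : Fin n → DFA m)
    → Σ (List (Fin m)) (InAll M)
    → (ℓ : ℕ) → IsMinLength (InAll M) ℓ
    → IsMinLength (Synchronizing M) (2 + ℓ)
lemma5p1 (suc (suc n)) m (s≤s (s≤s z≤n)) M _ ℓ ((w , w∈ , |w|≡ℓ) , minimal) =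
  ( accepting-word w
  , accepting-word-synchronizing w w∈
  , trans (length-accepting-word w) (cong (2 +_) |w|≡ℓ) )
  , shortest
  where
  shortest : ∀ v → Synchronizing M v → 2 + ℓ ≤ length v
  shortest v (x , sync) with synchronizing-word-has-accepted-factor v
                               (Equivalence.from (sync x) refl)
                               (λ v₀ e → Equivalence.to (sync _) (v₀ , e))
  ... | w′ , w′∈ , bound = ≤-trans (+-monoʳ-≤ 2 (minimal w′ w′∈)) bound
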